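{- Let $G$ and $H$ be finite simple graphs and let $G\circ H$ denote their corona product. If $H$ has a perfect matching, then \[\phi_{gm}(G\circ H) \le |E(G \circ H)| - \nu(G) - n(G)\,\nu(H),\] and if $H$ has no perfect matching, then \[\phi_{gm}(G\circ H) \le |E(G \circ H)|- n(G) - n(G)\,\nu(H).\]
   Context: For a graph $X$, $n(X)$ is its number of vertices and $\nu(X)$ its matching number (maximum size of a matching). A maximal matching is a matching not contained in any larger matching. A global forcing set for maximal matchings of $X$ is a set $S\subseteq E(X)$ such that $M_1\cap S\neq M_2\cap S$ for every two distinct maximal matchings $M_1,M_2$ of $X$; $\phi_{gm}(X)$ is the minimum size of such a set. The corona product $G\circ H$, where $V(G)=\{g_1,\dots,g_{n(G)}\}$, is obtained from the disjoint union of $G$ and $n(G)$ copies $H_1,\dots,H_{n(G)}$ of $H$ by joining, for each $i$, $g_i$ to every vertex of $H_i$. -}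

module Defs where

open import Data.Nat using (ℕ; _+_; _*_; _≤_; _<_)
open import Data.Nat.Properties using (_<?_)
open import Data.Bool using (Bool; true; false; _∧_; if_then_else_)
open import Data.Fin using (Fin; toℕ; splitAt; remQuot; _≟_)
open import Data.List using (allFin; map)
open import Data.Nat.ListAction using (sum)
open import Data.Sum using (_⊎_; inj₁; inj₂)
open import Data.Product using (Σ; ∃; _×_; _,_)
open import Relation.Nullary using (¬_)
open import Relation.Nullary.Decidable using (⌊_⌋)
open import Relation.Binary.PropositionalEquality using (_≡_)

record Graph : Set where
  field
    n   : ℕ
    adj : Fin n → Fin n → Bool
open Graph public

IsSimple : Graph → Set
IsSimple G = (∀ i j → adj G i j ≡ adj G j i) × (∀ i → adj G i i ≡ false)

-- Edge sets are represented symmetrically: S i j ≡ true means {i,j} ∈ S.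
EdgeSet : Graph → Set
EdgeSet G = Fin (n G) → Fin (n G) → Bool

IsEdgeSet : (G : Graph) → EdgeSet G → Set
IsEdgeSet G S = (∀ i j → S i j ≡ S j i) × (∀ i j → S i j ≡ true → adj G i j ≡ true)

count : ∀ {m} → (Fin m → Fin m → Bool) → ℕ
count {m} f = sum (map (λ i → sum (map (λ j →
  if ⌊ toℕ i <? toℕ j ⌋ ∧ f i j then 1 else 0) (allFin m))) (allFin m))

numEdges : Graph → ℕ
numEdges G = count (adj G)

size : ∀ {G} → EdgeSet G → ℕ
size S = count S

IsMatching : (G : Graph) → EdgeSet G → Set
IsMatching G M = IsEdgeSet G M × (∀ i j k → M i j ≡ true → M i k ≡ true → j ≡ k)

SubE : (G : Graph) → EdgeSet G → EdgeSet G → Set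
SubE G S T = ∀ i j → S i j ≡ true → T i j ≡ true

IsMaximalMatching : (G : Graph) → EdgeSet G → Set
IsMaximalMatching G M = IsMatching G M ×
  (∀ M′ → IsMatching G M′ → SubE G M M′ → SubE G M′ M)

HasPerfectMatching : Graph → Set
HasPerfectMatching G = Σ (EdgeSet G) λ M → IsMatching G M × (∀ v → ∃ λ u → M v u ≡ true)

IsMatchingNumber : Graph → ℕ → Set
IsMatchingNumber G k =
  (Σ (EdgeSet G) λ M → IsMatching G M × size {G} M ≡ k) ×
  (∀ M → IsMatching G M → size {G} M ≤ k)

SameEdges : ∀ {G} → EdgeSet G → EdgeSet G → Set
SameEdges S T = ∀ i j → S i j ≡ T i j

_∩E_ : ∀ {G} → EdgeSet G → EdgeSet G → EdgeSet G
(S ∩E T) i j = S i j ∧ T i j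

IsGlobalForcingSet : (G : Graph) → EdgeSet G → Set
IsGlobalForcingSet G S = IsEdgeSet G S ×
  (∀ M₁ M₂ → IsMaximalMatching G M₁ → IsMaximalMatching G M₂ →
     ¬ SameEdges {G} M₁ M₂ → ¬ SameEdges {G} (_∩E_ {G} M₁ S) (_∩E_ {G} M₂ S))

PhiGmAtMost : Graph → ℕ → Set
PhiGmAtMost G b = Σ (EdgeSet G) λ S → IsGlobalForcingSet G S × size {G} S ≤ b

-- corona product: vertices Fin (n G + n G * n H); the first n G are g_i,
-- vertex inj₂ p with remQuot p = (i , h) is vertex h of the copy H_i.
coronaAdj : (G H : Graph) → Fin (n G + n G * n H) → Fin (n G + n G * n H) → Bool
coronaAdj G H x y with splitAt (n G) x | splitAt (n G) y
... | inj₁ g | inj₁ g′ = adj G g g′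
... | inj₁ g | inj₂ q with remQuot {n G} (n H) q
...   | (i , _) = ⌊ g ≟ i ⌋
coronaAdj G H x y | inj₂ p | inj₁ g with remQuot {n G} (n H) p
...   | (i , _) = ⌊ g ≟ i ⌋
coronaAdj G H x y | inj₂ p | inj₂ q with remQuot {n G} (n H) p | remQuot {n G} (n H) q
...   | (i , h) | (i′ , h′) = ⌊ i ≟ i′ ⌋ ∧ adj H h h′

_∘c_ : Graph → Graph → Graph
G ∘c H = record { n = n G + n G * n H ; adj = coronaAdj G H }

-- For every matching T of a graph X, the edges of X outside T form a global
-- forcing set for maximal matchings: if two maximal matchings agree outside T
-- but M₁ has an edge uw ∈ T that M₂ lacks, maximality of M₂ covers u (or w) by
-- an edge uk ≠ uw, which lies outside T because T is a matching, hence is also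
-- in M₁, contradicting that M₁ is a matching. So φ_gm(X) ≤ |E(X)| − |T|, and
-- it remains to exhibit large matchings of G ∘ H: a maximum matching of G
-- together with a maximum matching of every copy of H, or, when H has no
-- perfect matching, the pendant edges g_i h₀ for a vertex h₀ missed by a
-- maximum matching of H, together with that matching in every copy.
module Submission where

open import Defs
open import Data.Nat.Properties using (_<?_; +-*-semiring; +-assoc; +-identityʳ; *-zeroʳ; *-identityʳ; m+n∸n≡m; ∸-+-assoc; ≤-reflexive; n≡⌊n+n/2⌋)
open import Algebra.Properties.Semiring.Sum +-*-semiring
  using (sum; sum-syntax; sum-cong-≗; ∑-distrib-+; ∑-comm; *-distribˡ-sum; sum-replicate-zero)
open import Data.Bool using (Bool; true; false; _∧_; _∨_; not; if_then_else_)
open import Data.Bool.Properties using (∧-identityʳ; ∧-zeroʳ; ∨-zeroʳ)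
import Data.Bool.Properties as Bool
open import Data.Empty using (⊥; ⊥-elim)
open import Data.Fin using (Fin; zero; suc; toℕ; _≟_; splitAt; remQuot; combine; join; _↑ˡ_; _↑ʳ_)
open import Data.Fin.Properties
  using (<-cmp; splitAt-↑ˡ; splitAt-↑ʳ; join-splitAt; remQuot-combine; combine-remQuot; any?; ¬∀⟶∃¬)
open import Data.List using (map; tabulate; allFin)
import Data.Nat.ListAction as List
open import Data.Nat using (ℕ; zero; suc; _+_; _*_; _∸_; ⌊_/2⌋)
open import Data.Nat.Tactic.RingSolver using (solve-∀)
open import Data.Product using (∃; _×_; _,_; proj₁; proj₂)
open import Data.Sum using (_⊎_; inj₁; inj₂)
open import Function using (_∘_; id)
open import Relation.Binary.Definitions using (tri<; tri≈; tri>)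
open import Relation.Binary.PropositionalEquality
open import Relation.Nullary using (¬_; Dec; yes; no; contradiction)
open import Relation.Nullary.Decidable using (⌊_⌋; isYes≗does; dec-true; dec-false; ⌊⌋-map′)

𝟙 : Bool → ℕ
𝟙 b = if b then 1 else 0

𝟙-∧ : ∀ a b → 𝟙 (a ∧ b) ≡ 𝟙 a * 𝟙 b
𝟙-∧ true  b = sym (+-identityʳ (𝟙 b))
𝟙-∧ false b = refl

∧-true : ∀ {a b} → a ∧ b ≡ true → a ≡ true × b ≡ true
∧-true {true} {true} _ = refl , refl

∨-∧-reverse : ∀ a b c d → (a ∧ b) ∨ (c ∧ d) ≡ (d ∧ c) ∨ (b ∧ a)
∨-∧-reverse a b c d = trans (Bool.∨-comm (a ∧ b) (c ∧ d)) (cong₂ _∨_ (Bool.∧-comm c d) (Bool.∧-comm a b))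

true≢false : true ≢ false
true≢false ()

⌊⌋-true : ∀ {A : Set} (a? : Dec A) → A → ⌊ a? ⌋ ≡ true
⌊⌋-true a? a = trans (isYes≗does a?) (dec-true a? a)

⌊⌋-false : ∀ {A : Set} (a? : Dec A) → ¬ A → ⌊ a? ⌋ ≡ false
⌊⌋-false a? ¬a = trans (isYes≗does a?) (dec-false a? ¬a)

≟-true : ∀ {m} {i j : Fin m} → ⌊ i ≟ j ⌋ ≡ true → i ≡ j
≟-true {i = i} {j} e with i ≟ j
≟-true _  | yes i≡j = i≡j
≟-true () | no  _

≟-sym : ∀ {m} (i j : Fin m) → ⌊ i ≟ j ⌋ ≡ ⌊ j ≟ i ⌋
≟-sym i j with i ≟ j
... | yes i≡j = sym (⌊⌋-true (j ≟ i) (sym i≡j))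
... | no  i≢j = sym (⌊⌋-false (j ≟ i) (i≢j ∘ sym))

∑-const : ∀ n c → ∑[ i < n ] c ≡ n * c
∑-const zero    c = refl
∑-const (suc n) c = cong (c +_) (∑-const n c)

∑-↑ : ∀ a b (f : Fin (a + b) → ℕ) →
      sum f ≡ ∑[ i < a ] f (i ↑ˡ b) + ∑[ j < b ] f (a ↑ʳ j)
∑-↑ zero    b f = refl
∑-↑ (suc a) b f = trans (cong (f zero +_) (∑-↑ a b (f ∘ suc))) (sym (+-assoc (f zero) _ _))

∑-combine : ∀ a b (f : Fin (a * b) → ℕ) →
            sum f ≡ ∑[ i < a ] ∑[ j < b ] f (combine i j)
∑-combine zero    b f = refl
∑-combine (suc a) b f =
  trans (∑-↑ b (a * b) f) (cong (∑[ j < b ] f (j ↑ˡ (a * b)) +_) (∑-combine a b (f ∘ (b ↑ʳ_))))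

∑-sift : ∀ {n} (i : Fin n) (f : Fin n → ℕ) → ∑[ j < n ] (𝟙 ⌊ i ≟ j ⌋ * f j) ≡ f i
∑-sift {suc n} zero    f = trans (cong₂ _+_ (+-identityʳ (f zero)) (sum-replicate-zero n)) (+-identityʳ (f zero))
∑-sift {suc n} (suc i) f =
  trans (sum-cong-≗ (λ j → cong (λ b → 𝟙 b * f (suc j)) (⌊⌋-map′ _ _ (i ≟ j)))) (∑-sift i (f ∘ suc))

∑∑-sift : ∀ {a b} (i : Fin a) (x : Fin b → Bool) →
          ∑[ i′ < a ] ∑[ h < b ] 𝟙 (⌊ i ≟ i′ ⌋ ∧ x h) ≡ ∑[ h < b ] 𝟙 (x h)
∑∑-sift {a} {b} i x = begin
  ∑[ i′ < a ] ∑[ h < b ] 𝟙 (⌊ i ≟ i′ ⌋ ∧ x h)      ≡⟨ sum-cong-≗ (λ i′ → sum-cong-≗ (λ h → 𝟙-∧ ⌊ i ≟ i′ ⌋ (x h))) ⟩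
  ∑[ i′ < a ] ∑[ h < b ] (𝟙 ⌊ i ≟ i′ ⌋ * 𝟙 (x h))  ≡⟨ sum-cong-≗ (λ i′ → sym (*-distribˡ-sum (𝟙 ⌊ i ≟ i′ ⌋) (𝟙 ∘ x))) ⟩
  ∑[ i′ < a ] (𝟙 ⌊ i ≟ i′ ⌋ * ∑[ h < b ] 𝟙 (x h))  ≡⟨ ∑-sift i (λ _ → ∑[ h < b ] 𝟙 (x h)) ⟩
  ∑[ h < b ] 𝟙 (x h)                                ∎
  where open ≡-Reasoning

listSum-map-tabulate : ∀ {m} {A : Set} (g : A → ℕ) (t : Fin m → A) →
                       List.sum (map g (tabulate t)) ≡ ∑[ i < m ] g (t i)
listSum-map-tabulate {zero}  g t = refl
listSum-map-tabulate {suc m} g t = cong (g (t zero) +_) (listSum-map-tabulate g (t ∘ suc))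

_<ᵇ_ : ∀ {m} → Fin m → Fin m → Bool
i <ᵇ j = ⌊ toℕ i <? toℕ j ⌋

upper : ∀ {m} → (Fin m → Fin m → Bool) → Fin m → Fin m → ℕ
upper f i j = 𝟙 (i <ᵇ j ∧ f i j)

count-∑ : ∀ {m} (f : Fin m → Fin m → Bool) → count f ≡ ∑[ i < m ] ∑[ j < m ] upper f i j
count-∑ {m} f = trans (listSum-map-tabulate (λ i → List.sum (map (upper f i) (allFin m))) id)
                      (sum-cong-≗ (λ i → listSum-map-tabulate (upper f i) id))

handshake : ∀ {m} (f : Fin m → Fin m → Bool) → (∀ i j → f i j ≡ f j i) → (∀ i → f i i ≡ false) →
            ∑[ i < m ] ∑[ j < m ] 𝟙 (f i j) ≡ count f + count f
handshake {m} f f-sym f-loopless = begin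
  ∑[ i < m ] ∑[ j < m ] 𝟙 (f i j)
    ≡⟨ sum-cong-≗ (λ i → trans (sum-cong-≗ (split i)) (∑-distrib-+ (upper f i) (λ j → upper f j i))) ⟩
  ∑[ i < m ] (∑[ j < m ] upper f i j + ∑[ j < m ] upper f j i)
    ≡⟨ ∑-distrib-+ (λ i → ∑[ j < m ] upper f i j) (λ i → ∑[ j < m ] upper f j i) ⟩
  ∑[ i < m ] ∑[ j < m ] upper f i j + ∑[ i < m ] ∑[ j < m ] upper f j i
    ≡⟨ cong (∑[ i < m ] ∑[ j < m ] upper f i j +_) (∑-comm (λ i j → upper f j i)) ⟩
  ∑[ i < m ] ∑[ j < m ] upper f i j + ∑[ j < m ] ∑[ i < m ] upper f j i
    ≡⟨ sym (cong₂ _+_ (count-∑ f) (count-∑ f)) ⟩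
  count f + count f ∎
  where
  open ≡-Reasoning
  split : ∀ i j → 𝟙 (f i j) ≡ upper f i j + upper f j i
  split i j with <-cmp i j
  ... | tri< i<j _ j≮i rewrite ⌊⌋-true (toℕ i <? toℕ j) i<j | ⌊⌋-false (toℕ j <? toℕ i) j≮i =
    sym (+-identityʳ _)
  ... | tri> i≮j _ j<i rewrite ⌊⌋-false (toℕ i <? toℕ j) i≮j | ⌊⌋-true (toℕ j <? toℕ i) j<i | f-sym j i =
    refl
  ... | tri≈ _ refl _ rewrite f-loopless i | ∧-zeroʳ (i <ᵇ i) = refl

count-complement : ∀ {m} (A T : Fin m → Fin m → Bool) → (∀ i j → T i j ≡ true → A i j ≡ true) →
                   count (λ i j → A i j ∧ not (T i j)) + count T ≡ count A
count-complement {m} A T T⊆A = begin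
  count A∖T + count T
    ≡⟨ cong₂ _+_ (count-∑ A∖T) (count-∑ T) ⟩
  ∑[ i < m ] ∑[ j < m ] upper A∖T i j + ∑[ i < m ] ∑[ j < m ] upper T i j
    ≡⟨ sym (∑-distrib-+ (λ i → ∑[ j < m ] upper A∖T i j) (λ i → ∑[ j < m ] upper T i j)) ⟩
  ∑[ i < m ] (∑[ j < m ] upper A∖T i j + ∑[ j < m ] upper T i j)
    ≡⟨ sum-cong-≗ (λ i → trans (sym (∑-distrib-+ (upper A∖T i) (upper T i)))
                               (sum-cong-≗ (λ j → pointwise (i <ᵇ j) (A i j) (T i j) (T⊆A i j)))) ⟩
  ∑[ i < m ] ∑[ j < m ] upper A i j
    ≡⟨ sym (count-∑ A) ⟩
  count A ∎
  where
  open ≡-Reasoning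
  A∖T : Fin m → Fin m → Bool
  A∖T i j = A i j ∧ not (T i j)
  pointwise : ∀ c a t → (t ≡ true → a ≡ true) → 𝟙 (c ∧ (a ∧ not t)) + 𝟙 (c ∧ t) ≡ 𝟙 (c ∧ a)
  pointwise false a     t     _ = refl
  pointwise true  a     false _ = trans (+-identityʳ _) (cong 𝟙 (∧-identityʳ a))
  pointwise true  true  true  _ = refl
  pointwise true  false true  t⇒a = contradiction (t⇒a refl) λ ()

count-∅ : ∀ {m} → count {m} (λ _ _ → false) ≡ 0
count-∅ {m} = trans (count-∑ {m} (λ _ _ → false)) (trans
  (sum-cong-≗ {m} (λ i → trans (sum-cong-≗ {m} (λ j → cong 𝟙 (∧-zeroʳ (i <ᵇ j)))) (sum-replicate-zero m)))
  (sum-replicate-zero m))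

double-injective : ∀ a b → a + a ≡ b + b → a ≡ b
double-injective a b e = trans (n≡⌊n+n/2⌋ a) (trans (cong ⌊_/2⌋ e) (sym (n≡⌊n+n/2⌋ b)))

-- Complements of matchings are global forcing sets

Covered : (X : Graph) → EdgeSet X → Fin (n X) → Set
Covered X M v = ∃ λ u → M v u ≡ true

covered? : (X : Graph) (M : EdgeSet X) (v : Fin (n X)) → Dec (Covered X M v)
covered? X M v = any? (λ u → M v u Bool.≟ true)

unmatched-vertex : (X : Graph) {M : EdgeSet X} → IsMatching X M → ¬ HasPerfectMatching X →
                   ∃ λ v → ¬ Covered X M v
unmatched-vertex X {M} M-matching no-perfect =
  ¬∀⟶∃¬ (n X) (Covered X M) (covered? X M) (λ all-covered → no-perfect (M , M-matching , all-covered))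

matching-loopless : (X : Graph) → (∀ i → adj X i i ≡ false) → (M : EdgeSet X) → IsMatching X M →
                    ∀ v → M v v ≡ false
matching-loopless X loopless M ((_ , M⊆adj) , _) v with M v v in e
... | false = refl
... | true  = contradiction (trans (sym (M⊆adj v v e)) (loopless v)) true≢false

module _ (X : Graph) (adj-sym : ∀ i j → adj X i j ≡ adj X j i) where

  insertEdge : EdgeSet X → Fin (n X) → Fin (n X) → EdgeSet X
  insertEdge M i j x y = M x y ∨ ((⌊ x ≟ i ⌋ ∧ ⌊ y ≟ j ⌋) ∨ (⌊ x ≟ j ⌋ ∧ ⌊ y ≟ i ⌋))

  module _ {M : EdgeSet X} (M-matching : IsMatching X M) {i j : Fin (n X)} (ij∈E : adj X i j ≡ true)
           (i-free : ¬ Covered X M i) (j-free : ¬ Covered X M j) where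

    private
      M-sym : ∀ x y → M x y ≡ M y x
      M-sym = proj₁ (proj₁ M-matching)
      M⊆adj : ∀ x y → M x y ≡ true → adj X x y ≡ true
      M⊆adj = proj₂ (proj₁ M-matching)
      M-fun : ∀ x y z → M x y ≡ true → M x z ≡ true → y ≡ z
      M-fun = proj₂ M-matching

    insertEdge-view : ∀ x y → insertEdge M i j x y ≡ true →
                      M x y ≡ true ⊎ (x ≡ i × y ≡ j) ⊎ (x ≡ j × y ≡ i)
    insertEdge-view x y e with M x y | ⌊ x ≟ i ⌋ ∧ ⌊ y ≟ j ⌋ in eij | ⌊ x ≟ j ⌋ ∧ ⌊ y ≟ i ⌋ in eji
    ... | true  | _     | _     = inj₁ refl
    ... | false | true  | _     = inj₂ (inj₁ (≟-true (proj₁ (∧-true eij)) , ≟-true (proj₂ (∧-true eij))))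
    ... | false | false | true  = inj₂ (inj₂ (≟-true (proj₁ (∧-true eji)) , ≟-true (proj₂ (∧-true eji))))

    insertEdge-isMatching : IsMatching X (insertEdge M i j)
    insertEdge-isMatching = (symmetric , ⊆adj) , functional
      where
      symmetric : ∀ x y → insertEdge M i j x y ≡ insertEdge M i j y x
      symmetric x y = cong₂ _∨_ (M-sym x y) (∨-∧-reverse ⌊ x ≟ i ⌋ ⌊ y ≟ j ⌋ ⌊ x ≟ j ⌋ ⌊ y ≟ i ⌋)

      ⊆adj : ∀ x y → insertEdge M i j x y ≡ true → adj X x y ≡ true
      ⊆adj x y e with insertEdge-view x y e
      ... | inj₁ xy∈M               = M⊆adj x y xy∈M
      ... | inj₂ (inj₁ (refl , refl)) = ij∈E
      ... | inj₂ (inj₂ (refl , refl)) = trans (adj-sym x y) ij∈E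

      functional : ∀ x y z → insertEdge M i j x y ≡ true → insertEdge M i j x z ≡ true → y ≡ z
      functional x y z e f with insertEdge-view x y e | insertEdge-view x z f
      ... | inj₁ xy | inj₁ xz                         = M-fun x y z xy xz
      ... | inj₁ xy | inj₂ (inj₁ (refl , _))          = ⊥-elim (i-free (y , xy))
      ... | inj₁ xy | inj₂ (inj₂ (refl , _))          = ⊥-elim (j-free (y , xy))
      ... | inj₂ (inj₁ (refl , _)) | inj₁ xz          = ⊥-elim (i-free (z , xz))
      ... | inj₂ (inj₂ (refl , _)) | inj₁ xz          = ⊥-elim (j-free (z , xz))
      ... | inj₂ (inj₁ (refl , refl)) | inj₂ (inj₁ (_ , refl)) = refl
      ... | inj₂ (inj₁ (refl , refl)) | inj₂ (inj₂ (x≡j , refl)) = sym x≡j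
      ... | inj₂ (inj₂ (refl , refl)) | inj₂ (inj₁ (x≡i , refl)) = sym x≡i
      ... | inj₂ (inj₂ (refl , refl)) | inj₂ (inj₂ (_ , refl)) = refl

    insertEdge-⊇ : SubE X M (insertEdge M i j)
    insertEdge-⊇ x y xy∈M rewrite xy∈M = refl

    insertEdge-∋ : insertEdge M i j i j ≡ true
    insertEdge-∋ rewrite ⌊⌋-true (i ≟ i) refl | ⌊⌋-true (j ≟ j) refl = ∨-zeroʳ (M i j)

  maximal-covers-edge : ∀ {M} → IsMaximalMatching X M → ∀ {i j} → adj X i j ≡ true →
                        Covered X M i ⊎ Covered X M j
  maximal-covers-edge {M} (M-matching , M-maximal) {i} {j} ij∈E with covered? X M i | covered? X M j
  ... | yes i-covered | _             = inj₁ i-covered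
  ... | no  _         | yes j-covered = inj₂ j-covered
  ... | no  i-free    | no  j-free    =
    inj₁ (j , M-maximal _ (insertEdge-isMatching M-matching ij∈E i-free j-free)
                          (insertEdge-⊇ M-matching ij∈E i-free j-free) i j
                          (insertEdge-∋ M-matching ij∈E i-free j-free))

  complementIn : EdgeSet X → EdgeSet X
  complementIn T i j = adj X i j ∧ not (T i j)

  module _ {T : EdgeSet X} (T-matching : IsMatching X T) where

    private
      S : EdgeSet X
      S = complementIn T
      T-fun : ∀ x y z → T x y ≡ true → T x z ≡ true → y ≡ z
      T-fun = proj₂ T-matching

      AgreeOnS : EdgeSet X → EdgeSet X → Set
      AgreeOnS M₁ M₂ = SameEdges {X} (_∩E_ {X} M₁ S) (_∩E_ {X} M₂ S)

      agree-at : ∀ {M₁ M₂} → AgreeOnS M₁ M₂ → ∀ i j → S i j ≡ true → M₁ i j ≡ M₂ i j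
      agree-at {M₁} {M₂} agree i j ij∈S = begin
        M₁ i j           ≡⟨ sym (∧-identityʳ _) ⟩
        M₁ i j ∧ true    ≡⟨ cong (M₁ i j ∧_) (sym ij∈S) ⟩
        M₁ i j ∧ S i j   ≡⟨ agree i j ⟩
        M₂ i j ∧ S i j   ≡⟨ cong (M₂ i j ∧_) ij∈S ⟩
        M₂ i j ∧ true    ≡⟨ ∧-identityʳ _ ⟩
        M₂ i j           ∎
        where open ≡-Reasoning

      ∉T⇒∈S : ∀ {i j} → adj X i j ≡ true → T i j ≡ false → S i j ≡ true
      ∉T⇒∈S ij∈E ij∉T rewrite ij∈E | ij∉T = refl

      module _ {M₁ M₂ : EdgeSet X} (M₁-matching : IsMatching X M₁) (M₂-matching : IsMatching X M₂)
               (agree : AgreeOnS M₁ M₂) {u w : Fin (n X)}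
               (uw∈M₁ : M₁ u w ≡ true) (uw∉M₂ : M₂ u w ≡ false) where

        lost-edge-∈T : T u w ≡ true
        lost-edge-∈T with T u w in uw∈T
        ... | true  = refl
        ... | false = contradiction
          (trans (sym uw∈M₁) (trans (agree-at {M₁} {M₂} agree u w (∉T⇒∈S (proj₂ (proj₁ M₁-matching) u w uw∈M₁) uw∈T)) uw∉M₂))
          true≢false

        lost-edge-uncovered : ∀ k → M₂ u k ≡ true → ⊥
        lost-edge-uncovered k uk∈M₂ = k≢w (sym (proj₂ M₁-matching u w k uw∈M₁ uk∈M₁))
          where
          k≢w : ¬ k ≡ w
          k≢w refl = true≢false (trans (sym uk∈M₂) uw∉M₂)
          uk∉T : T u k ≡ false
          uk∉T with T u k in uk∈T
          ... | false = refl
          ... | true  = ⊥-elim (k≢w (sym (T-fun u w k lost-edge-∈T uk∈T)))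
          uk∈M₁ : M₁ u k ≡ true
          uk∈M₁ = trans (agree-at {M₁} {M₂} agree u k (∉T⇒∈S (proj₂ (proj₁ M₂-matching) u k uk∈M₂) uk∉T)) uk∈M₂

      no-lost-edge : ∀ {M₁ M₂} → IsMatching X M₁ → IsMaximalMatching X M₂ → AgreeOnS M₁ M₂ →
                     ∀ u w → M₁ u w ≡ true → M₂ u w ≡ false → ⊥
      no-lost-edge {M₁} {M₂} M₁-matching M₂-maximal@(M₂-matching , _) agree u w uw∈M₁ uw∉M₂
        with maximal-covers-edge M₂-maximal (proj₂ (proj₁ M₁-matching) u w uw∈M₁)
      ... | inj₁ (k , uk∈M₂) =
        lost-edge-uncovered M₁-matching M₂-matching agree uw∈M₁ uw∉M₂ k uk∈M₂
      ... | inj₂ (k , wk∈M₂) =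
        lost-edge-uncovered M₁-matching M₂-matching agree
          (trans (proj₁ (proj₁ M₁-matching) w u) uw∈M₁) (trans (proj₁ (proj₁ M₂-matching) w u) uw∉M₂) k wk∈M₂

      agreeOnS⇒same : ∀ {M₁ M₂} → IsMaximalMatching X M₁ → IsMaximalMatching X M₂ →
                      AgreeOnS M₁ M₂ → SameEdges {X} M₁ M₂
      agreeOnS⇒same {M₁} {M₂} M₁-maximal M₂-maximal agree i j with M₁ i j in e₁ | M₂ i j in e₂
      ... | true  | true  = refl
      ... | false | false = refl
      ... | true  | false = ⊥-elim (no-lost-edge (proj₁ M₁-maximal) M₂-maximal agree i j e₁ e₂)
      ... | false | true  = ⊥-elim (no-lost-edge (proj₁ M₂-maximal) M₁-maximal (λ a b → sym (agree a b)) i j e₂ e₁)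

    complement-isGlobalForcingSet : IsGlobalForcingSet X (complementIn T)
    complement-isGlobalForcingSet =
      ((λ i j → cong₂ _∧_ (adj-sym i j) (cong not (proj₁ (proj₁ T-matching) i j))) ,
       (λ i j e → proj₁ (∧-true e))) ,
      λ M₁ M₂ M₁-maximal M₂-maximal M₁≢M₂ agree → M₁≢M₂ (agreeOnS⇒same M₁-maximal M₂-maximal agree)

    phiGm≤numEdges∸size : PhiGmAtMost X (numEdges X ∸ size {X} T)
    phiGm≤numEdges∸size = complementIn T , complement-isGlobalForcingSet , ≤-reflexive size-complement
      where
      size-complement : size {X} (complementIn T) ≡ numEdges X ∸ size {X} T
      size-complement = trans (sym (m+n∸n≡m _ (size {X} T)))
                              (cong (_∸ size {X} T) (count-complement (adj X) T (proj₂ (proj₁ T-matching))))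

phiGm≤-∸-+ : ∀ X {k} a b → k ≡ a + b → PhiGmAtMost X (numEdges X ∸ k) → PhiGmAtMost X (numEdges X ∸ a ∸ b)
phiGm≤-∸-+ X a b refl = subst (PhiGmAtMost X) (sym (∸-+-assoc (numEdges X) a b))

-- The corona product, indexed by Fin n(G) ⊎ Fin n(G) × Fin n(H)

module Corona (G H : Graph) where

  V : Set
  V = Fin (n G) ⊎ (Fin (n G) × Fin (n H))

  fromSplit : Fin (n G) ⊎ Fin (n G * n H) → V
  fromSplit (inj₁ g) = inj₁ g
  fromSplit (inj₂ p) = inj₂ (remQuot {n G} (n H) p)

  toV : Fin (n (G ∘c H)) → V
  toV = fromSplit ∘ splitAt (n G)

  fromV : V → Fin (n (G ∘c H))
  fromV (inj₁ g)       = g ↑ˡ (n G * n H)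
  fromV (inj₂ (i , h)) = n G ↑ʳ combine i h

  fromV-toV : ∀ x → fromV (toV x) ≡ x
  fromV-toV x with splitAt (n G) x in eq
  ... | inj₁ g = trans (cong (join (n G) (n G * n H)) (sym eq)) (join-splitAt (n G) (n G * n H) x)
  ... | inj₂ p = trans (cong (n G ↑ʳ_) (combine-remQuot {n G} (n H) p))
                       (trans (cong (join (n G) (n G * n H)) (sym eq)) (join-splitAt (n G) (n G * n H) x))

  toV-injective : ∀ {x y} → toV x ≡ toV y → x ≡ y
  toV-injective {x} {y} e = trans (sym (fromV-toV x)) (trans (cong fromV e) (fromV-toV y))

  adjV : V → V → Bool
  adjV (inj₁ g)       (inj₁ g′)        = adj G g g′
  adjV (inj₁ g)       (inj₂ (i , _))   = ⌊ g ≟ i ⌋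
  adjV (inj₂ (i , _)) (inj₁ g)         = ⌊ g ≟ i ⌋
  adjV (inj₂ (i , h)) (inj₂ (i′ , h′)) = ⌊ i ≟ i′ ⌋ ∧ adj H h h′

  coronaAdj-toV : ∀ x y → coronaAdj G H x y ≡ adjV (toV x) (toV y)
  coronaAdj-toV x y with splitAt (n G) x | splitAt (n G) y
  ... | inj₁ g | inj₁ g′ = refl
  ... | inj₁ g | inj₂ q with remQuot {n G} (n H) q
  ...   | _ = refl
  coronaAdj-toV x y | inj₂ p | inj₁ g with remQuot {n G} (n H) p
  ...   | _ = refl
  coronaAdj-toV x y | inj₂ p | inj₂ q with remQuot {n G} (n H) p | remQuot {n G} (n H) q
  ...   | _ | _ = refl

  adjV-sym : (∀ i j → adj G i j ≡ adj G j i) → (∀ i j → adj H i j ≡ adj H j i) →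
             ∀ v w → adjV v w ≡ adjV w v
  adjV-sym G-sym H-sym (inj₁ g)       (inj₁ g′)        = G-sym g g′
  adjV-sym G-sym H-sym (inj₁ _)       (inj₂ _)         = refl
  adjV-sym G-sym H-sym (inj₂ _)       (inj₁ _)         = refl
  adjV-sym G-sym H-sym (inj₂ (i , h)) (inj₂ (i′ , h′)) = cong₂ _∧_ (≟-sym i i′) (H-sym h h′)

  ∑V : (V → ℕ) → ℕ
  ∑V f = ∑[ g < n G ] f (inj₁ g) + ∑[ i < n G ] ∑[ h < n H ] f (inj₂ (i , h))

  ∑-toV : ∀ (f : V → ℕ) → ∑[ x < n (G ∘c H) ] f (toV x) ≡ ∑V f
  ∑-toV f = trans (∑-↑ (n G) (n G * n H) (f ∘ toV)) (cong₂ _+_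
    (sum-cong-≗ (λ g → cong (f ∘ fromSplit) (splitAt-↑ˡ (n G) g (n G * n H))))
    (trans (sum-cong-≗ (λ p → cong (f ∘ fromSplit) (splitAt-↑ʳ (n G) (n G * n H) p)))
      (trans (∑-combine (n G) (n H) (λ p → f (inj₂ (remQuot {n G} (n H) p))))
        (sum-cong-≗ (λ i → sum-cong-≗ (λ h → cong (f ∘ inj₂) (remQuot-combine i h)))))))

double-count-arith : ∀ p g q m →
  (p + p + g * q) + g * (q + (m + m)) ≡ (p + g * q + g * m) + (p + g * q + g * m)
double-count-arith = solve-∀

module CoronaMatching (G H : Graph) (G-simple : IsSimple G) (H-simple : IsSimple H)
  {P : EdgeSet G} (P-matching : IsMatching G P)
  {M : EdgeSet H} (M-matching : IsMatching H M)
  (q : Fin (n H) → Bool)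
  (q-unique : ∀ h h′ → q h ≡ true → q h′ ≡ true → h ≡ h′)
  (q-unmatched : ∀ h h′ → q h ≡ true → M h h′ ≡ true → ⊥)
  (P-or-q-empty : ∀ g g′ h → P g g′ ≡ true → q h ≡ true → ⊥) where

  open Corona G H

  private
    P-sym : ∀ g g′ → P g g′ ≡ P g′ g
    P-sym = proj₁ (proj₁ P-matching)
    M-sym : ∀ h h′ → M h h′ ≡ M h′ h
    M-sym = proj₁ (proj₁ M-matching)
    M⊆adj : ∀ h h′ → M h h′ ≡ true → adj H h h′ ≡ true
    M⊆adj = proj₂ (proj₁ M-matching)
    P-loopless : ∀ g → P g g ≡ false
    P-loopless = matching-loopless G (proj₂ G-simple) P P-matching
    M-loopless : ∀ h → M h h ≡ false
    M-loopless = matching-loopless H (proj₂ H-simple) M M-matching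

  R : V → V → Bool
  R (inj₁ g)       (inj₁ g′)        = P g g′
  R (inj₁ g)       (inj₂ (i , h))   = ⌊ g ≟ i ⌋ ∧ q h
  R (inj₂ (i , h)) (inj₁ g)         = ⌊ g ≟ i ⌋ ∧ q h
  R (inj₂ (i , h)) (inj₂ (i′ , h′)) = ⌊ i ≟ i′ ⌋ ∧ M h h′

  R-sym : ∀ v w → R v w ≡ R w v
  R-sym (inj₁ g)       (inj₁ g′)        = P-sym g g′
  R-sym (inj₁ _)       (inj₂ _)         = refl
  R-sym (inj₂ _)       (inj₁ _)         = refl
  R-sym (inj₂ (i , h)) (inj₂ (i′ , h′)) = cong₂ _∧_ (≟-sym i i′) (M-sym h h′)

  R⊆adjV : ∀ v w → R v w ≡ true → adjV v w ≡ true
  R⊆adjV (inj₁ g)       (inj₁ g′)        e = proj₂ (proj₁ P-matching) g g′ e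
  R⊆adjV (inj₁ g)       (inj₂ (i , h))   e = proj₁ (∧-true e)
  R⊆adjV (inj₂ (i , h)) (inj₁ g)         e = proj₁ (∧-true e)
  R⊆adjV (inj₂ (i , h)) (inj₂ (i′ , h′)) e with ∧-true {⌊ i ≟ i′ ⌋} e
  ... | i≟i′ , hh′∈M = cong₂ _∧_ i≟i′ (M⊆adj h h′ hh′∈M)

  R-functional : ∀ v w w′ → R v w ≡ true → R v w′ ≡ true → w ≡ w′
  R-functional (inj₁ g) (inj₁ a) (inj₁ b) e f = cong inj₁ (proj₂ P-matching g a b e f)
  R-functional (inj₁ g) (inj₁ a) (inj₂ (_ , h)) e f = ⊥-elim (P-or-q-empty g a h e (proj₂ (∧-true f)))
  R-functional (inj₁ g) (inj₂ (_ , h)) (inj₁ b) e f = ⊥-elim (P-or-q-empty g b h f (proj₂ (∧-true e)))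
  R-functional (inj₁ g) (inj₂ (i , h)) (inj₂ (i′ , h′)) e f
    with ∧-true {⌊ g ≟ i ⌋} e | ∧-true {⌊ g ≟ i′ ⌋} f
  ... | g≟i , qh | g≟i′ , qh′ with ≟-true g≟i | ≟-true g≟i′
  ... | refl | refl = cong (λ h → inj₂ (g , h)) (q-unique h h′ qh qh′)
  R-functional (inj₂ (i , h)) (inj₁ g) (inj₁ g′) e f
    with ≟-true (proj₁ (∧-true {⌊ g ≟ i ⌋} e)) | ≟-true (proj₁ (∧-true {⌊ g′ ≟ i ⌋} f))
  ... | refl | refl = refl
  R-functional (inj₂ (i , h)) (inj₁ g) (inj₂ (i′ , h′)) e f
    with ≟-true (proj₁ (∧-true {⌊ i ≟ i′ ⌋} f))
  ... | refl = ⊥-elim (q-unmatched h h′ (proj₂ (∧-true {⌊ g ≟ i ⌋} e)) (proj₂ (∧-true f)))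
  R-functional (inj₂ (i , h)) (inj₂ (i′ , h′)) (inj₁ g) e f
    with ≟-true (proj₁ (∧-true {⌊ i ≟ i′ ⌋} e))
  ... | refl = ⊥-elim (q-unmatched h h′ (proj₂ (∧-true {⌊ g ≟ i ⌋} f)) (proj₂ (∧-true e)))
  R-functional (inj₂ (i , h)) (inj₂ (i₁ , h₁)) (inj₂ (i₂ , h₂)) e f
    with ∧-true {⌊ i ≟ i₁ ⌋} e | ∧-true {⌊ i ≟ i₂ ⌋} f
  ... | i≟i₁ , hh₁∈M | i≟i₂ , hh₂∈M with ≟-true i≟i₁ | ≟-true i≟i₂
  ... | refl | refl = cong (λ h′ → inj₂ (i , h′)) (proj₂ M-matching h h₁ h₂ hh₁∈M hh₂∈M)

  R-loopless : ∀ v → R v v ≡ false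
  R-loopless (inj₁ g)       = P-loopless g
  R-loopless (inj₂ (i , h)) = trans (cong (⌊ i ≟ i ⌋ ∧_) (M-loopless h)) (∧-zeroʳ _)

  T : EdgeSet (G ∘c H)
  T x y = R (toV x) (toV y)

  T-matching : IsMatching (G ∘c H) T
  T-matching = ((λ x y → R-sym (toV x) (toV y)) ,
                (λ x y e → trans (coronaAdj-toV x y) (R⊆adjV (toV x) (toV y) e))) ,
               (λ x y z e f → toV-injective (R-functional (toV x) (toV y) (toV z) e f))

  |q| : ℕ
  |q| = ∑[ h < n H ] 𝟙 (q h)

  matchingSize : ℕ
  matchingSize = size {G} P + n G * |q| + n G * size {H} M

  degree-sum : ∑V (λ v → ∑V (λ w → 𝟙 (R v w))) ≡ matchingSize + matchingSize
  degree-sum = begin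
    ∑V (λ v → ∑V (λ w → 𝟙 (R v w)))
      ≡⟨ cong₂ _+_ (sum-cong-≗ row₁) (sum-cong-≗ (λ i → sum-cong-≗ (row₂ i))) ⟩
    ∑[ g < n G ] (∑[ g′ < n G ] 𝟙 (P g g′) + |q|) + ∑[ i < n G ] ∑[ h < n H ] (𝟙 (q h) + ∑[ h′ < n H ] 𝟙 (M h h′))
      ≡⟨ cong₂ _+_ (trans (∑-distrib-+ (λ g → ∑[ g′ < n G ] 𝟙 (P g g′)) (λ _ → |q|))
                          (cong₂ _+_ (handshake P P-sym P-loopless) (∑-const (n G) |q|)))
                   (trans (sum-cong-≗ {n G} (λ _ → trans (∑-distrib-+ (𝟙 ∘ q) (λ h → ∑[ h′ < n H ] 𝟙 (M h h′)))
                                                   (cong (|q| +_) (handshake M M-sym M-loopless))))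
                          (∑-const (n G) (|q| + (size {H} M + size {H} M)))) ⟩
    (size {G} P + size {G} P + n G * |q|) + n G * (|q| + (size {H} M + size {H} M))
      ≡⟨ double-count-arith (size {G} P) (n G) |q| (size {H} M) ⟩
    matchingSize + matchingSize ∎
    where
    open ≡-Reasoning
    row₁ : ∀ g → ∑V (λ w → 𝟙 (R (inj₁ g) w)) ≡ ∑[ g′ < n G ] 𝟙 (P g g′) + |q|
    row₁ g = cong (∑[ g′ < n G ] 𝟙 (P g g′) +_) (∑∑-sift g q)
    row₂ : ∀ i h → ∑V (λ w → 𝟙 (R (inj₂ (i , h)) w)) ≡ 𝟙 (q h) + ∑[ h′ < n H ] 𝟙 (M h h′)
    row₂ i h = cong₂ _+_
      (trans (sum-cong-≗ (λ g → trans (cong (λ b → 𝟙 (b ∧ q h)) (≟-sym g i)) (𝟙-∧ ⌊ i ≟ g ⌋ (q h))))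
             (∑-sift i (λ _ → 𝟙 (q h))))
      (∑∑-sift i (M h))

  -- Degree sums, unlike count, do not depend on the order of the vertices,
  -- so they survive the reindexing toV.
  size-T : size {G ∘c H} T ≡ matchingSize
  size-T = double-injective (size {G ∘c H} T) matchingSize (begin
    count T + count T
      ≡⟨ sym (handshake T (proj₁ (proj₁ T-matching)) (R-loopless ∘ toV)) ⟩
    ∑[ x < n (G ∘c H) ] ∑[ y < n (G ∘c H) ] 𝟙 (T x y)
      ≡⟨ sum-cong-≗ (λ x → ∑-toV (λ w → 𝟙 (R (toV x) w))) ⟩
    ∑[ x < n (G ∘c H) ] ∑V (λ w → 𝟙 (R (toV x) w))
      ≡⟨ ∑-toV (λ v → ∑V (λ w → 𝟙 (R v w))) ⟩
    ∑V (λ v → ∑V (λ w → 𝟙 (R v w)))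
      ≡⟨ degree-sum ⟩
    matchingSize + matchingSize ∎)
    where open ≡-Reasoning

  phiGm≤numEdges∸matchingSize : PhiGmAtMost (G ∘c H) (numEdges (G ∘c H) ∸ matchingSize)
  phiGm≤numEdges∸matchingSize = subst (λ t → PhiGmAtMost (G ∘c H) (numEdges (G ∘c H) ∸ t)) size-T
    (phiGm≤numEdges∸size (G ∘c H) corona-sym T-matching)
    where
    corona-sym : ∀ x y → coronaAdj G H x y ≡ coronaAdj G H y x
    corona-sym x y = trans (coronaAdj-toV x y)
      (trans (adjV-sym (proj₁ G-simple) (proj₁ H-simple) (toV x) (toV y)) (sym (coronaAdj-toV y x)))

module _ (G H : Graph) (G-simple : IsSimple G) (H-simple : IsSimple H)
         {MH : EdgeSet H} (MH-matching : IsMatching H MH) where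

  phiGm-corona-via-matchings : ∀ {MG} → IsMatching G MG →
    PhiGmAtMost (G ∘c H) (numEdges (G ∘c H) ∸ size {G} MG ∸ n G * size {H} MH)
  phiGm-corona-via-matchings {MG} MG-matching =
    phiGm≤-∸-+ (G ∘c H) (size {G} MG) (n G * size {H} MH) matchingSize≡ CM.phiGm≤numEdges∸matchingSize
    where
    module CM = CoronaMatching G H G-simple H-simple MG-matching MH-matching (λ _ → false)
                               (λ _ _ ()) (λ _ _ ()) (λ _ _ _ _ ())
    matchingSize≡ : CM.matchingSize ≡ size {G} MG + n G * size {H} MH
    matchingSize≡ rewrite sum-replicate-zero (n H) | *-zeroʳ (n G) | +-identityʳ (size {G} MG) = refl

  phiGm-corona-via-pendants : ∀ {h₀} → ¬ Covered H MH h₀ →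
    PhiGmAtMost (G ∘c H) (numEdges (G ∘c H) ∸ n G ∸ n G * size {H} MH)
  phiGm-corona-via-pendants {h₀} h₀-free =
    phiGm≤-∸-+ (G ∘c H) (n G) (n G * size {H} MH) matchingSize≡ CM.phiGm≤numEdges∸matchingSize
    where
    module CM = CoronaMatching G H G-simple H-simple {P = λ _ _ → false} ((((λ _ _ → refl) , λ _ _ ())) , λ _ _ _ ())
                               MH-matching (λ h → ⌊ h₀ ≟ h ⌋)
                               (λ h h′ e f → trans (sym (≟-true e)) (≟-true f))
                               (λ h h′ e hh′∈MH → h₀-free (h′ , subst (λ v → MH v h′ ≡ true) (sym (≟-true e)) hh′∈MH))
                               (λ _ _ _ ())
    matchingSize≡ : CM.matchingSize ≡ n G + n G * size {H} MH
    matchingSize≡ rewrite count-∅ {n G} | trans (sum-cong-≗ (λ h → sym (*-identityʳ (𝟙 ⌊ h₀ ≟ h ⌋)))) (∑-sift h₀ (λ _ → 1))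
                        | *-identityʳ (n G) = refl

-- The first bound holds whether or not H has a perfect matching.
mainTheorem2 : (G H : Graph) → IsSimple G → IsSimple H →
    (νG νH : ℕ) → IsMatchingNumber G νG → IsMatchingNumber H νH →
    (HasPerfectMatching H →
       PhiGmAtMost (G ∘c H) (numEdges (G ∘c H) ∸ νG ∸ n G * νH)) ×
    (¬ HasPerfectMatching H →
       PhiGmAtMost (G ∘c H) (numEdges (G ∘c H) ∸ n G ∸ n G * νH))
mainTheorem2 G H G-simple H-simple _ _ ((MG , MG-matching , refl) , _) ((MH , MH-matching , refl) , _) =
  (λ _ → phiGm-corona-via-matchings G H G-simple H-simple MH-matching MG-matching) ,
  (λ no-perfect → phiGm-corona-via-pendants G H G-simple H-simple MH-matching
                    (proj₂ (unmatched-vertex H MH-matching no-perfect)))
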